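{- Let $n_0,e,q\ge1$ be integers such that every prime number dividing $n_0$ divides $q-1$. Then (1) $\sum_{i=0}^{n_0e-1}q^i\equiv0\pmod{n_0}$, and (2) $\sum_{i=0}^{n_0e-1}(n_0e-1-i)\,q^i\equiv0\pmod{n_0'}$, where $n_0'=n_0$ if $n_0$ is odd and $n_0'=n_0/2$ if $n_0$ is even. -}

module Defs where

open import Data.Nat using (ℕ; zero; suc; _+_; _*_; _∸_; _^_; _/_; _%_)
open import Data.Bool using (if_then_else_)
open import Data.Nat using (_≡ᵇ_)

sumRange : ℕ → (ℕ → ℕ) → ℕ
sumRange zero    f = 0
sumRange (suc m) f = sumRange m f + f m

n₀′ : ℕ → ℕ
n₀′ n = if (n % 2) ≡ᵇ 0 then n / 2 else n

{-# OPTIONS --safe #-}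
-- Write S_q(N) = Σ_{i<N} q^i and V_q(N) = Σ_{k<N} S_q(k); V_q(N) is the second sum of the
-- statement. Cutting a range of length p·m into p blocks of length m gives, with Q = q^m,
--   S_q(pm) = S_Q(p) · S_q(m)   and   V_q(pm) = V_Q(p) · m S_q(m) + S_Q(p) · V_q(m).
-- If p ∣ q − 1 then Q ≡ 1 (mod p), so S_Q(p) ≡ p ≡ 0 and V_Q(p) ≡ p(p−1)/2 (mod p); the
-- latter vanishes for odd p. Peeling the prime factors of n₀ off one at a time proves both
-- claims; for p = 2 only S_Q(2) is known to be even, which is why n₀′ halves n₀.
module Submission where

open import Defs
open import Data.Nat using (ℕ; _+_; _*_; _∸_; _^_; _≥_)
open import Data.Nat.Divisibility using (_∣_)
open import Data.Nat.Primality using (Prime)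
open import Data.Product using (_×_)

open import Data.Nat using (zero; suc; _<_; s≤s; NonZero; >-nonZero; _%_)
open import Data.Nat.Properties
open import Data.Nat.DivMod
open import Data.Nat.Divisibility hiding (_∣_)
open import Data.Nat.Coprimality using (Coprime; coprime-divisor)
open import Data.Nat.Primality
  using (prime[2]; irreducible[2]; prime⇒irreducible; prime⇒nonZero; euclidsLemma)
open import Data.Nat.Primality.Factorisation using (factorise)
open import Data.Nat.ListAction using (product)
open import Data.Nat.ListAction.Properties using (∈⇒∣product)
open import Data.Nat.Tactic.RingSolver using (solve-∀)
open import Data.List using ([]; _∷_)
open import Data.List.Relation.Unary.All as All using (All; []; _∷_)
open import Data.Product using (_,_; proj₁; proj₂; map₂)
open import Data.Sum using (_⊎_; inj₁; inj₂; [_,_]′)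
open import Relation.Nullary using (¬_; yes; no; contradiction)
open import Relation.Binary.PropositionalEquality

sumRange-cong : ∀ N {f g : ℕ → ℕ} → (∀ i → i < N → f i ≡ g i) → sumRange N f ≡ sumRange N g
sumRange-cong zero    f≗g = refl
sumRange-cong (suc N) f≗g =
  cong₂ _+_ (sumRange-cong N (λ i i<N → f≗g i (m<n⇒m<1+n i<N))) (f≗g N ≤-refl)

sumRange-+ : ∀ N (f g : ℕ → ℕ) → sumRange N (λ i → f i + g i) ≡ sumRange N f + sumRange N g
sumRange-+ zero    f g = refl
sumRange-+ (suc N) f g rewrite sumRange-+ N f g =
  interchange (sumRange N f) (sumRange N g) (f N) (g N)
  where
  interchange : ∀ a b c d → a + b + (c + d) ≡ a + c + (b + d)
  interchange = solve-∀

sumRange-*ˡ : ∀ N c (f : ℕ → ℕ) → sumRange N (λ i → c * f i) ≡ c * sumRange N f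
sumRange-*ˡ zero    c f = sym (*-zeroʳ c)
sumRange-*ˡ (suc N) c f rewrite sumRange-*ˡ N c f = sym (*-distribˡ-+ c (sumRange N f) (f N))

sumRange-const : ∀ N c → sumRange N (λ _ → c) ≡ N * c
sumRange-const zero    c = refl
sumRange-const (suc N) c rewrite sumRange-const N c = +-comm (N * c) c

sumRange-split : ∀ a b (f : ℕ → ℕ) →
                 sumRange (a + b) f ≡ sumRange a f + sumRange b (λ i → f (a + i))
sumRange-split a zero    f rewrite +-identityʳ a = sym (+-identityʳ _)
sumRange-split a (suc b) f rewrite +-suc a b | sumRange-split a b f =
  +-assoc (sumRange a f) _ (f (a + b))

sumRange-partialSums : ∀ N (f : ℕ → ℕ) →
                       sumRange N (λ k → sumRange k f) ≡ sumRange N (λ i → (N ∸ 1 ∸ i) * f i)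
sumRange-partialSums zero    f = refl
sumRange-partialSums (suc N) f = begin
  sumRange N (λ k → sumRange k f) + sumRange N f
    ≡⟨ +-comm _ (sumRange N f) ⟩
  sumRange N f + sumRange N (λ k → sumRange k f)
    ≡⟨ cong (sumRange N f +_) (sumRange-partialSums N f) ⟩
  sumRange N f + sumRange N (λ i → (N ∸ 1 ∸ i) * f i)
    ≡⟨ sumRange-+ N f _ ⟨
  sumRange N (λ i → f i + (N ∸ 1 ∸ i) * f i)
    ≡⟨ sumRange-cong N peel ⟩
  sumRange N (λ i → (N ∸ i) * f i)
    ≡⟨ +-identityʳ _ ⟨
  sumRange N (λ i → (N ∸ i) * f i) + 0
    ≡⟨ cong (λ x → sumRange N (λ i → (N ∸ i) * f i) + x * f N) (n∸n≡0 N) ⟨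
  sumRange N (λ i → (N ∸ i) * f i) + (N ∸ N) * f N ∎
  where
  open ≡-Reasoning
  peel : ∀ i → i < N → f i + (N ∸ 1 ∸ i) * f i ≡ (N ∸ i) * f i
  peel i (s≤s i≤N-1) rewrite +-∸-assoc 1 i≤N-1 = refl

geomSum : ℕ → ℕ → ℕ
geomSum q N = sumRange N (q ^_)

sumGeomSums : ℕ → ℕ → ℕ
sumGeomSums q N = sumRange N (geomSum q)

triangle : ℕ → ℕ
triangle N = sumRange N (λ k → k)

geomSum-+ : ∀ q a b → geomSum q (a + b) ≡ geomSum q a + q ^ a * geomSum q b
geomSum-+ q a b = begin
  geomSum q (a + b)
    ≡⟨ sumRange-split a b (q ^_) ⟩
  geomSum q a + sumRange b (λ i → q ^ (a + i))
    ≡⟨ cong (geomSum q a +_) (sumRange-cong b (λ i _ → ^-distribˡ-+-* q a i)) ⟩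
  geomSum q a + sumRange b (λ i → q ^ a * q ^ i)
    ≡⟨ cong (geomSum q a +_) (sumRange-*ˡ b (q ^ a) (q ^_)) ⟩
  geomSum q a + q ^ a * geomSum q b ∎
  where open ≡-Reasoning

sumGeomSums-+ : ∀ q a b →
  sumGeomSums q (a + b) ≡ sumGeomSums q a + b * geomSum q a + q ^ a * sumGeomSums q b
sumGeomSums-+ q a b = begin
  sumGeomSums q (a + b)
    ≡⟨ sumRange-split a b (geomSum q) ⟩
  sumGeomSums q a + sumRange b (λ i → geomSum q (a + i))
    ≡⟨ cong (sumGeomSums q a +_) (sumRange-cong b (λ i _ → geomSum-+ q a i)) ⟩
  sumGeomSums q a + sumRange b (λ i → geomSum q a + q ^ a * geomSum q i)
    ≡⟨ cong (sumGeomSums q a +_) (sumRange-+ b _ _) ⟩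
  sumGeomSums q a + (sumRange b (λ _ → geomSum q a) + sumRange b (λ i → q ^ a * geomSum q i))
    ≡⟨ cong₂ (λ x y → sumGeomSums q a + (x + y))
             (sumRange-const b (geomSum q a)) (sumRange-*ˡ b (q ^ a) (geomSum q)) ⟩
  sumGeomSums q a + (b * geomSum q a + q ^ a * sumGeomSums q b)
    ≡⟨ sym (+-assoc (sumGeomSums q a) _ _) ⟩
  sumGeomSums q a + b * geomSum q a + q ^ a * sumGeomSums q b ∎
  where open ≡-Reasoning

geomSum-suc : ∀ q k → geomSum q (suc k) ≡ 1 + q * geomSum q k
geomSum-suc q k rewrite geomSum-+ q 1 k | *-identityʳ q = refl

sumGeomSums-suc : ∀ q k → sumGeomSums q (suc k) ≡ k + q * sumGeomSums q k
sumGeomSums-suc q k rewrite sumGeomSums-+ q 1 k | *-identityʳ q | *-identityʳ k = refl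

geomSum-* : ∀ q m k → geomSum q (k * m) ≡ geomSum (q ^ m) k * geomSum q m
geomSum-* q m zero    = refl
geomSum-* q m (suc k)
  rewrite geomSum-+ q m (k * m) | geomSum-* q m k | geomSum-suc (q ^ m) k =
  ring (geomSum q m) (q ^ m) (geomSum (q ^ m) k)
  where
  ring : ∀ S Q G → S + Q * (G * S) ≡ (1 + Q * G) * S
  ring = solve-∀

sumGeomSums-* : ∀ q m k →
  sumGeomSums q (k * m) ≡
  sumGeomSums (q ^ m) k * (m * geomSum q m) + geomSum (q ^ m) k * sumGeomSums q m
sumGeomSums-* q m zero    = refl
sumGeomSums-* q m (suc k)
  rewrite sumGeomSums-+ q m (k * m) | sumGeomSums-* q m k
        | geomSum-suc (q ^ m) k | sumGeomSums-suc (q ^ m) k =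
  ring m k (geomSum q m) (sumGeomSums q m) (q ^ m) (sumGeomSums (q ^ m) k) (geomSum (q ^ m) k)
  where
  ring : ∀ m k S V Q W G →
         V + k * m * S + Q * (W * (m * S) + G * V) ≡ (k + Q * W) * (m * S) + (1 + Q * G) * V
  ring = solve-∀

triangle-*2 : ∀ n → 2 * triangle (suc n) ≡ suc n * n
triangle-*2 zero    = refl
triangle-*2 (suc n) = begin
  2 * (triangle (suc n) + suc n) ≡⟨ *-distribˡ-+ 2 (triangle (suc n)) (suc n) ⟩
  2 * triangle (suc n) + 2 * suc n ≡⟨ cong (_+ 2 * suc n) (triangle-*2 n) ⟩
  suc n * n + 2 * suc n ≡⟨ ring n ⟩
  suc (suc n) * suc n ∎
  where
  open ≡-Reasoning
  ring : ∀ n → suc n * n + 2 * suc n ≡ suc (suc n) * suc n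
  ring = solve-∀

odd⇒coprime-2 : ∀ {n} → ¬ 2 ∣ n → Coprime n 2
odd⇒coprime-2 2∤n (i∣n , i∣2) with irreducible[2] i∣2
... | inj₁ i≡1 = i≡1
... | inj₂ refl = contradiction i∣n 2∤n

odd⇒∣triangle : ∀ {n} → ¬ 2 ∣ n → n ∣ triangle n
odd⇒∣triangle {zero}  2∤n = contradiction (2 ∣0) 2∤n
odd⇒∣triangle {suc n} 2∤n =
  coprime-divisor (odd⇒coprime-2 2∤n) (divides n (trans (triangle-*2 n) (*-comm (suc n) n)))

prime⇒odd⊎≡2 : ∀ {p} → Prime p → ¬ 2 ∣ p ⊎ p ≡ 2
prime⇒odd⊎≡2 {p} pp with 2 ∣? p
... | no 2∤p = inj₁ 2∤p
... | yes 2∣p with prime⇒irreducible pp 2∣p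
...   | inj₂ 2≡p = inj₂ (sym 2≡p)

module _ {p : ℕ} .{{_ : NonZero p}} where

  sumRange-cong-mod : ∀ N {f g : ℕ → ℕ} → (∀ i → f i % p ≡ g i % p) →
                      sumRange N f % p ≡ sumRange N g % p
  sumRange-cong-mod zero    f≡g = refl
  sumRange-cong-mod (suc N) {f} {g} f≡g = begin
    (sumRange N f + f N) % p             ≡⟨ %-distribˡ-+ (sumRange N f) (f N) p ⟩
    (sumRange N f % p + f N % p) % p
      ≡⟨ cong₂ (λ x y → (x + y) % p) (sumRange-cong-mod N f≡g) (f≡g N) ⟩
    (sumRange N g % p + g N % p) % p     ≡⟨ %-distribˡ-+ (sumRange N g) (g N) p ⟨
    (sumRange N g + g N) % p             ∎
    where open ≡-Reasoning

  ∣⇒suc-≡1-mod : ∀ {r} → p ∣ r → suc r % p ≡ 1 % p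
  ∣⇒suc-≡1-mod p∣r = %-remove-+ʳ 1 p∣r

  ^-≡1-mod : ∀ {x} i → x % p ≡ 1 % p → x ^ i % p ≡ 1 % p
  ^-≡1-mod     zero    x≡1 = refl
  ^-≡1-mod {x} (suc i) x≡1 = begin
    (x * x ^ i) % p            ≡⟨ %-distribˡ-* x (x ^ i) p ⟩
    (x % p * (x ^ i % p)) % p  ≡⟨ cong₂ (λ a b → (a * b) % p) x≡1 (^-≡1-mod i x≡1) ⟩
    (1 % p * (1 % p)) % p      ≡⟨ %-distribˡ-* 1 1 p ⟨
    1 % p                      ∎
    where open ≡-Reasoning

  geomSum-≡-mod : ∀ {Q} k → Q % p ≡ 1 % p → geomSum Q k % p ≡ k % p
  geomSum-≡-mod {Q} k Q≡1 = begin
    geomSum Q k % p            ≡⟨ sumRange-cong-mod k (λ i → ^-≡1-mod i Q≡1) ⟩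
    sumRange k (λ _ → 1) % p   ≡⟨ cong (_% p) (trans (sumRange-const k 1) (*-identityʳ k)) ⟩
    k % p                      ∎
    where open ≡-Reasoning

  ∣geomSum : ∀ {Q} → Q % p ≡ 1 % p → p ∣ geomSum Q p
  ∣geomSum Q≡1 = m%n≡0⇒n∣m _ p (trans (geomSum-≡-mod p Q≡1) (n%n≡0 p))

  odd⇒∣sumGeomSums : ∀ {Q} → ¬ 2 ∣ p → Q % p ≡ 1 % p → p ∣ sumGeomSums Q p
  odd⇒∣sumGeomSums {Q} 2∤p Q≡1 = m%n≡0⇒n∣m _ p (begin
    sumGeomSums Q p % p  ≡⟨ sumRange-cong-mod p (λ k → geomSum-≡-mod k Q≡1) ⟩
    triangle p % p       ≡⟨ n∣m⇒m%n≡0 _ p (odd⇒∣triangle 2∤p) ⟩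
    0                    ∎)
    where open ≡-Reasoning

n₀′-*2 : ∀ n → n₀′ (n * 2) ≡ n
n₀′-*2 n rewrite m*n%n≡0 n 2 {{_}} = m*n/n≡m n 2

n₀′-odd : ∀ {n} → ¬ 2 ∣ n → n₀′ n ≡ n
n₀′-odd {n} 2∤n with n % 2 in n%2≡
... | zero  = contradiction (m%n≡0⇒n∣m n 2 n%2≡) 2∤n
... | suc _ = refl

n₀′-*-odd : ∀ {m} n → ¬ 2 ∣ m → n₀′ (m * n) ≡ m * n₀′ n
n₀′-*-odd {m} n 2∤m with 2 ∣? n
... | yes (divides j refl) = begin
  n₀′ (m * (j * 2)) ≡⟨ cong n₀′ (*-assoc m j 2) ⟨
  n₀′ (m * j * 2)   ≡⟨ n₀′-*2 (m * j) ⟩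
  m * j             ≡⟨ cong (m *_) (n₀′-*2 j) ⟨
  m * n₀′ (j * 2)   ∎
  where open ≡-Reasoning
... | no 2∤n = trans (n₀′-odd 2∤m*n) (cong (m *_) (sym (n₀′-odd 2∤n)))
  where
  2∤m*n : ¬ 2 ∣ m * n
  2∤m*n 2∣m*n = [ 2∤m , 2∤n ]′ (euclidsLemma m n prime[2] 2∣m*n)

n₀′∣ : ∀ n → n₀′ n ∣ n
n₀′∣ n with 2 ∣? n
... | yes (divides j refl) rewrite n₀′-*2 j = m∣m*n 2
... | no 2∤n rewrite n₀′-odd 2∤n = ∣-refl

∣2*n₀′ : ∀ n → n ∣ 2 * n₀′ n
∣2*n₀′ n with 2 ∣? n
... | yes (divides j refl) rewrite n₀′-*2 j = ∣-reflexive (*-comm j 2)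
... | no 2∤n rewrite n₀′-odd 2∤n = n∣m*n 2

module _ {q m k : ℕ} (k∣S : k ∣ geomSum q m) where

  *-∣geomSum : ∀ p .{{_ : NonZero p}} → q ^ m % p ≡ 1 % p → p * k ∣ geomSum q (p * m)
  *-∣geomSum p Q≡1 rewrite geomSum-* q m p = *-pres-∣ (∣geomSum Q≡1) k∣S

  module _ (n₀′k∣V : n₀′ k ∣ sumGeomSums q m) where

    odd-*-∣sumGeomSums : ∀ p .{{_ : NonZero p}} → ¬ 2 ∣ p → q ^ m % p ≡ 1 % p →
                         n₀′ (p * k) ∣ sumGeomSums q (p * m)
    odd-*-∣sumGeomSums p 2∤p Q≡1 rewrite sumGeomSums-* q m p | n₀′-*-odd k 2∤p =
      ∣m∣n⇒∣m+n (*-pres-∣ (odd⇒∣sumGeomSums 2∤p Q≡1)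
                          (∣-trans (n₀′∣ k) (∣-trans k∣S (n∣m*n m))))
                (*-pres-∣ (∣geomSum Q≡1) n₀′k∣V)

    2*-∣sumGeomSums : q ^ m % 2 ≡ 1 % 2 → n₀′ (2 * k) ∣ sumGeomSums q (2 * m)
    2*-∣sumGeomSums Q≡1 rewrite sumGeomSums-* q m 2 | *-comm 2 k | n₀′-*2 k =
      ∣m∣n⇒∣m+n (∣-trans k∣S (∣-trans (n∣m*n m) (n∣m*n (sumGeomSums (q ^ m) 2))))
                (∣-trans (∣2*n₀′ k) (*-pres-∣ (∣geomSum {2} {q ^ m} Q≡1) n₀′k∣V))

    prime-*-∣sumGeomSums : ∀ p .{{_ : NonZero p}} → Prime p → q ^ m % p ≡ 1 % p →
                           n₀′ (p * k) ∣ sumGeomSums q (p * m)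
    prime-*-∣sumGeomSums p pp Q≡1 with prime⇒odd⊎≡2 pp
    ... | inj₁ 2∤p = odd-*-∣sumGeomSums p 2∤p Q≡1
    ... | inj₂ refl = 2*-∣sumGeomSums Q≡1

geomSums-divisible : ∀ r ps → All Prime ps → All (_∣ r) ps → ∀ e →
  product ps ∣ geomSum (suc r) (product ps * e) ×
  n₀′ (product ps) ∣ sumGeomSums (suc r) (product ps * e)
geomSums-divisible r []       []         []           e = 1∣ _ , 1∣ _
geomSums-divisible r (p ∷ ps) (pp ∷ pps) (p∣r ∷ ps∣r) e rewrite *-assoc p (product ps) e =
  *-∣geomSum k∣S p Q≡1 , prime-*-∣sumGeomSums k∣S n₀′k∣V p pp Q≡1
  where
  instance
    p≢0 : NonZero p
    p≢0 = prime⇒nonZero pp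
  Q≡1 : suc r ^ (product ps * e) % p ≡ 1 % p
  Q≡1 = ^-≡1-mod (product ps * e) (∣⇒suc-≡1-mod p∣r)
  k∣S : product ps ∣ geomSum (suc r) (product ps * e)
  k∣S = proj₁ (geomSums-divisible r ps pps ps∣r e)
  n₀′k∣V : n₀′ (product ps) ∣ sumGeomSums (suc r) (product ps * e)
  n₀′k∣V = proj₂ (geomSums-divisible r ps pps ps∣r e)

lemmaA5 : (n₀ e q : ℕ) → n₀ ≥ 1 → e ≥ 1 → q ≥ 1
        → (∀ p → Prime p → p ∣ n₀ → p ∣ (q ∸ 1))
        → (n₀ ∣ sumRange (n₀ * e) (λ i → q ^ i))
          × (n₀′ n₀ ∣ sumRange (n₀ * e) (λ i → (n₀ * e ∸ 1 ∸ i) * q ^ i))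
lemmaA5 n₀ e zero    _    _ () _
lemmaA5 n₀ e (suc r) n₀≥1 _ _ hyp with factorise n₀ {{>-nonZero n₀≥1}}
... | record { factors = ps ; isFactorisation = refl ; factorsPrime = pps } =
  map₂ (subst (n₀′ n₀ ∣_) (sumRange-partialSums (n₀ * e) (suc r ^_)))
       (geomSums-divisible r ps pps ps∣r e)
  where
  ps∣r : All (_∣ r) ps
  ps∣r = All.tabulate (λ p∈ps → hyp _ (All.lookup pps p∈ps) (∈⇒∣product p∈ps))
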